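{- Let $T$ be a tree of order $n\ge 4$ that is not isomorphic to the star $K_{1,n-1}$. Then $\gamma_{tc}(M(T))\le 2n-4$.
   Context: All graphs are finite, simple and undirected. For a graph $H$, a set $D\subseteq V(H)$ is a total dominating set if every vertex of $H$ has a neighbor in $D$. A set $D\subseteq V(H)$ is a total outer-connected dominating set of $H$ if $D$ is a total dominating set and the induced subgraph $H[V(H)\setminus D]$ is connected; $\gamma_{tc}(H)$ denotes the minimum cardinality of a total outer-connected dominating set of $H$. The middle graph $M(G)$ of a graph $G$ has vertex set $V(G)\cup E(G)$, where two elements $x,y$ are adjacent iff either $x,y\in E(G)$ are edges of $G$ sharing an endpoint, or one of them is a vertex of $G$ and the other is an edge of $G$ incident to it. -}

module Defs where

open import Data.Nat using (ℕ; _≤_)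
open import Data.Fin using (Fin; zero; suc) renaming (_<_ to _<ᶠ_)
open import Data.Bool using (Bool; true; false)
open import Data.List using (List; []; _∷_; length; _∷ʳ_)
open import Data.List.Membership.Propositional using (_∈_; _∉_)
open import Data.List.Relation.Unary.Unique.Propositional using (Unique)
open import Data.List.Relation.Unary.Linked using (Linked)
open import Data.Product using (Σ; ∃; _×_; _,_; proj₁; proj₂)
open import Data.Sum using (_⊎_; inj₁; inj₂)
open import Data.Empty using (⊥)
open import Data.Unit using (⊤)
open import Relation.Nullary using (¬_)
open import Relation.Binary.PropositionalEquality using (_≡_; _≢_)
open import Function.Bundles using (_↔_; Inverse)

record SimpleGraph (n : ℕ) : Set where
  field
    adj    : Fin n → Fin n → Bool
    sym    : ∀ i j → adj i j ≡ adj j i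
    irrefl : ∀ i → adj i i ≡ false

open SimpleGraph public

Adj : ∀ {n} → SimpleGraph n → Fin n → Fin n → Set
Adj G i j = adj G i j ≡ true

record Graph : Set₁ where
  field
    V   : Set
    _~_ : V → V → Set

open Graph public

data WalkIn (G : Graph) (P : V G → Set) : V G → V G → Set where
  here : ∀ {x} → P x → WalkIn G P x x
  step : ∀ {x y z} → P x → _~_ G x y → WalkIn G P y z → WalkIn G P x z

InducedConnected : (G : Graph) → (V G → Set) → Set
InducedConnected G P = ∀ x y → P x → P y → WalkIn G P x y

asGraph : ∀ {n} → SimpleGraph n → Graph
asGraph {n} G = record { V = Fin n ; _~_ = Adj G }

Connected : ∀ {n} → SimpleGraph n → Set
Connected G = InducedConnected (asGraph G) (λ _ → ⊤)

HasCycle : ∀ {n} → SimpleGraph n → Set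
HasCycle {n} G =
  Σ (Fin n) λ x → Σ (List (Fin n)) λ ys →
    (2 ≤ length ys) × Unique (x ∷ ys) × Linked (Adj G) ((x ∷ ys) ∷ʳ x)

Acyclic : ∀ {n} → SimpleGraph n → Set
Acyclic G = ¬ HasCycle G

IsTree : ∀ {n} → SimpleGraph n → Set
IsTree G = Connected G × Acyclic G

Isomorphic : ∀ {n m} → SimpleGraph n → SimpleGraph m → Set
Isomorphic {n} {m} G H =
  Σ (Fin n ↔ Fin m) λ f → ∀ i j → adj G i j ≡ adj H (Inverse.to f i) (Inverse.to f j)

starAdj : ∀ {n} → Fin n → Fin n → Bool
starAdj zero    zero    = false
starAdj zero    (suc _) = true
starAdj (suc _) zero    = true
starAdj (suc _) (suc _) = false

starSym : ∀ {n} (i j : Fin n) → starAdj i j ≡ starAdj j i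
starSym zero    zero    = _≡_.refl
starSym zero    (suc _) = _≡_.refl
starSym (suc _) zero    = _≡_.refl
starSym (suc _) (suc _) = _≡_.refl

starIrr : ∀ {n} (i : Fin n) → starAdj i i ≡ false
starIrr zero    = _≡_.refl
starIrr (suc _) = _≡_.refl

Star : (n : ℕ) → SimpleGraph n
Star n = record { adj = starAdj ; sym = starSym ; irrefl = starIrr }

-- Edges of G: pairs i < j with i adjacent to j (each edge exactly once)

Edge : ∀ {n} → SimpleGraph n → Set
Edge {n} G = Σ (Fin n) λ i → Σ (Fin n) λ j → (i <ᶠ j) × Adj G i j

endA : ∀ {n} {G : SimpleGraph n} → Edge G → Fin n
endA e = proj₁ e
endB : ∀ {n} {G : SimpleGraph n} → Edge G → Fin n
endB e = proj₁ (proj₂ e)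

Incident : ∀ {n} {G : SimpleGraph n} → Fin n → Edge G → Set
Incident {G = G} v e = (v ≡ endA {G = G} e) ⊎ (v ≡ endB {G = G} e)

ShareEnd : ∀ {n} {G : SimpleGraph n} → Edge G → Edge G → Set
ShareEnd {n} {G} e f = Σ (Fin n) λ v → Incident {G = G} v e × Incident {G = G} v f

MAdj : ∀ {n} (G : SimpleGraph n) → (Fin n ⊎ Edge G) → (Fin n ⊎ Edge G) → Set
MAdj G (inj₁ v) (inj₁ w) = ⊥
MAdj G (inj₁ v) (inj₂ e) = Incident {G = G} v e
MAdj G (inj₂ e) (inj₁ v) = Incident {G = G} v e
MAdj G (inj₂ e) (inj₂ f) = (e ≢ f) × ShareEnd {G = G} e f

Middle : ∀ {n} → SimpleGraph n → Graph
Middle {n} G = record { V = Fin n ⊎ Edge G ; _~_ = MAdj G }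

IsTotalDominating : (H : Graph) → List (V H) → Set
IsTotalDominating H D = ∀ x → Σ (V H) λ y → (y ∈ D) × _~_ H x y

IsTOCDS : (H : Graph) → List (V H) → Set
IsTOCDS H D = Unique D × IsTotalDominating H D × InducedConnected H (λ x → x ∉ D)

γtc≤ : (H : Graph) → ℕ → Set
γtc≤ H k = Σ (List (V H)) λ D → IsTOCDS H D × (length D ≤ k)

-- Since T is not a star, it has an edge uv whose ends have further
-- neighbours a of u and b of v. Deleting u, uv and v from M(T) leaves a
-- total dominating set: u is dominated by ua, v by vb, any other vertex by an
-- incident edge, an edge by an end outside {u, v} if it has one and otherwise
-- (it is uv) by ua. The deleted elements induce the path u – uv – v, and as T
-- has n − 1 edges the set has n + (n − 1) − 3 = 2n − 4 elements.
module Submission where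

open import Defs hiding (sym)
open import Data.Nat using (ℕ; zero; suc; _+_; _*_; _∸_; _≤_; s≤s; z≤n)
import Data.Nat.Properties as ℕₚ
open import Data.Nat.Solver using (module +-*-Solver)
open import Data.Fin using (Fin; zero; suc) renaming (_<_ to _<ᶠ_)
open import Data.Fin.Properties using (_≟_; <-cmp; <-irrelevant; <-irrefl; any?)
open import Data.Fin.Permutation using (Permutation′; transpose)
open import Data.Bool using (Bool; true; false)
import Data.Bool.Properties as Boolₚ
open import Data.List using (List; []; _∷_; length; _++_; [_]; _∷ʳ_; map; allFin; filter; deduplicate)
open import Data.List.Properties using (length-++; ++-assoc; length-map; length-tabulate)
open import Data.List.Membership.Propositional using (_∈_; _∉_; find; lose)
open import Data.List.Membership.Propositional.Properties
  using (∈-∃++; ∈-++⁺ˡ; ∈-++⁺ʳ; ∈-map⁺; ∈-allFin; ∈-filter⁺; ∈-filter⁻; ∈-deduplicate⁺; ∈-deduplicate⁻)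
import Data.List.Membership.DecPropositional as DecMembership
open import Data.List.Relation.Binary.Subset.Propositional using (_⊆_)
open import Data.List.Relation.Unary.Any using (here; there)
import Data.List.Relation.Unary.Any as Any
open import Data.List.Relation.Unary.All using (All; []; _∷_)
import Data.List.Relation.Unary.All as All
import Data.List.Relation.Unary.All.Properties as Allₚ
open import Data.List.Relation.Unary.AllPairs using ([]; _∷_)
open import Data.List.Relation.Unary.Unique.Propositional using (Unique)
import Data.List.Relation.Unary.Unique.Propositional.Properties as Uniqueₚ
open import Data.List.Relation.Unary.Unique.DecPropositional.Properties using (deduplicate-!)
open import Data.List.Relation.Unary.Linked using (Linked; []; [-]; _∷_)
open import Data.Product using (Σ; ∃; ∃₂; _×_; _,_; proj₁; proj₂)
open import Data.Sum using (_⊎_; inj₁; inj₂)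
import Data.Sum.Properties as Sumₚ
open import Data.Unit using (tt)
open import Function.Base using (id; _∘′_)
open import Function.Bundles using (Inverse)
open import Relation.Nullary using (¬_; Dec; yes; no; ¬?; contradiction)
open import Relation.Nullary.Decidable using (_×-dec_; _⊎-dec_; map′)
open import Relation.Binary.PropositionalEquality
  using (_≡_; _≢_; refl; sym; trans; cong; cong₂; subst; module ≡-Reasoning)
open import Relation.Binary.Definitions using (tri<; tri≈; tri>)
open import Axiom.UniquenessOfIdentityProofs using (module Decidable⇒UIP)

module _ {A : Set} where

  length-++-∷ : ∀ (B C : List A) {x} → length (B ++ x ∷ C) ≡ suc (length (B ++ C))
  length-++-∷ []      C = refl
  length-++-∷ (_ ∷ B) C = cong suc (length-++-∷ B C)

  ∈-++-∷⁻ : ∀ (B C : List A) {x z} → z ∈ B ++ x ∷ C → z ≢ x → z ∈ B ++ C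
  ∈-++-∷⁻ []      C (here refl)  z≢x = contradiction refl z≢x
  ∈-++-∷⁻ []      C (there z∈C)  _   = z∈C
  ∈-++-∷⁻ (_ ∷ B) C (here refl)  _   = here refl
  ∈-++-∷⁻ (_ ∷ B) C (there z∈BC) z≢x = there (∈-++-∷⁻ B C z∈BC z≢x)

  Unique-++-∷⁻ : ∀ (B C : List A) {x} → Unique (B ++ x ∷ C) → Unique (B ++ C)
  Unique-++-∷⁻ []      C (_ ∷ u) = u
  Unique-++-∷⁻ (_ ∷ B) C (b∉ ∷ u) with Allₚ.++⁻ B b∉
  ... | b∉B , _ ∷ b∉C = Allₚ.++⁺ b∉B b∉C ∷ Unique-++-∷⁻ B C u

  Unique-++⁻ˡ : ∀ (xs : List A) {ys} → Unique (xs ++ ys) → Unique xs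
  Unique-++⁻ˡ []       _        = []
  Unique-++⁻ˡ (x ∷ xs) (x∉ ∷ u) = Allₚ.++⁻ˡ xs x∉ ∷ Unique-++⁻ˡ xs u

  Unique⇒length≤ : ∀ {xs ys : List A} → Unique xs → xs ⊆ ys → length xs ≤ length ys
  Unique⇒length≤ {[]}     _          _     = z≤n
  Unique⇒length≤ {x ∷ xs} (x∉xs ∷ u) xs⊆ys with ∈-∃++ (xs⊆ys (here refl))
  ... | B , C , refl = subst (suc (length xs) ≤_) (sym (length-++-∷ B C))
          (s≤s (Unique⇒length≤ u xs⊆B++C))
    where
    xs⊆B++C : xs ⊆ B ++ C
    xs⊆B++C z∈xs = ∈-++-∷⁻ B C (xs⊆ys (there z∈xs)) (λ z≡x → All.lookup x∉xs z∈xs (sym z≡x))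

  module _ {R : A → A → Set} where

    Linked-++⁻ˡ : ∀ (xs : List A) {ys} → Linked R (xs ++ ys) → Linked R xs
    Linked-++⁻ˡ []           _        = []
    Linked-++⁻ˡ (_ ∷ [])     _        = [-]
    Linked-++⁻ˡ (_ ∷ y ∷ xs) (r ∷ rs) = r ∷ Linked-++⁻ˡ (y ∷ xs) rs

    Linked-∷ʳ : ∀ (xs : List A) {y z} → Linked R (xs ∷ʳ y) → R y z → Linked R (xs ∷ʳ y ∷ʳ z)
    Linked-∷ʳ []           _        ryz = ryz ∷ [-]
    Linked-∷ʳ (_ ∷ [])     (r ∷ _)  ryz = r ∷ ryz ∷ [-]
    Linked-∷ʳ (_ ∷ x ∷ xs) (r ∷ rs) ryz = r ∷ Linked-∷ʳ (x ∷ xs) rs ryz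

module _ {G : Graph} {P : V G → Set} where

  WalkIn-++ : ∀ {x y z} → WalkIn G P x y → WalkIn G P y z → WalkIn G P x z
  WalkIn-++ (here _)      w′ = w′
  WalkIn-++ (step px r w) w′ = step px r (WalkIn-++ w w′)

  WalkIn-preserves : {R : V G → Set} → (∀ {x y} → R x → _~_ G x y → R y) →
                     ∀ {x y} → WalkIn G P x y → R x → R y
  WalkIn-preserves closed (here _)     Rx = Rx
  WalkIn-preserves closed (step _ r w) Rx = WalkIn-preserves closed w (closed Rx r)

  WalkIn-firstStep : ∀ {x y} → WalkIn G P x y → x ≢ y → ∃ (_~_ G x)
  WalkIn-firstStep (here _)     x≢x = contradiction refl x≢x
  WalkIn-firstStep (step _ r _) _   = _ , r

  InducedConnected-hub : ∀ h → (∀ x → P x → WalkIn G P x h) → (∀ y → P y → WalkIn G P h y) →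
                         InducedConnected G P
  InducedConnected-hub h to from x y px py = WalkIn-++ (to x px) (from y py)

module _ {n : ℕ} (G : SimpleGraph n) where

  Adj-sym : ∀ {i j} → Adj G i j → Adj G j i
  Adj-sym {i} {j} ij = trans (SimpleGraph.sym G j i) ij

  Adj⇒≢ : ∀ {i j} → Adj G i j → i ≢ j
  Adj⇒≢ {i} ii refl with trans (sym ii) (irrefl G i)
  ... | ()

  Adj? : ∀ i j → Dec (Adj G i j)
  Adj? i j = adj G i j Boolₚ.≟ true

  Adj-irrelevant : ∀ {i j} (p q : Adj G i j) → p ≡ q
  Adj-irrelevant = Decidable⇒UIP.≡-irrelevant Boolₚ._≟_

  connected⇒neighbour : Connected G → ∀ {x y} → x ≢ y → ∃ (Adj G x)
  connected⇒neighbour connected {x} {y} = WalkIn-firstStep (connected x y tt tt)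

  connected-closed : Connected G → {R : Fin n → Set} → (∀ {x y} → R x → Adj G x y → R y) →
                     ∀ {x} → R x → ∀ y → R y
  connected-closed connected closed {x} Rx y = WalkIn-preserves closed (connected x y tt tt) Rx

  lo hi : Edge G → Fin n
  lo = endA {G = G}
  hi = endB {G = G}

  Edge-ext : (f g : Edge G) → lo f ≡ lo g → hi f ≡ hi g → f ≡ g
  Edge-ext (i , j , i<j , ij) (.i , .j , i<j′ , ij′) refl refl
    with <-irrelevant i<j i<j′ | Adj-irrelevant ij ij′
  ... | refl | refl = refl

  _≟ᴱ_ : (f g : Edge G) → Dec (f ≡ g)
  f ≟ᴱ g with lo f ≟ lo g | hi f ≟ hi g
  ... | yes p | yes q = yes (Edge-ext f g p q)
  ... | no ¬p | _     = no (λ f≡g → ¬p (cong lo f≡g))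
  ... | yes _ | no ¬q = no (λ f≡g → ¬q (cong hi f≡g))

  edgeBetween : ∀ x y → Adj G x y → Edge G
  edgeBetween x y xy with <-cmp x y
  ... | tri< x<y _ _ = x , y , x<y , xy
  ... | tri≈ _ x≡y _ = contradiction x≡y (Adj⇒≢ xy)
  ... | tri> _ _ y<x = y , x , y<x , Adj-sym xy

  edgeBetween-< : ∀ {x y} (xy : Adj G x y) (x<y : x <ᶠ y) → edgeBetween x y xy ≡ (x , y , x<y , xy)
  edgeBetween-< {x} {y} xy x<y with <-cmp x y
  ... | tri< _ _ _   = Edge-ext _ _ refl refl
  ... | tri≈ _ x≡y _ = contradiction x≡y (Adj⇒≢ xy)
  ... | tri> _ _ y<x = contradiction x<y (ℕₚ.<-asym y<x)

  edgeBetween-> : ∀ {x y} (xy : Adj G x y) (y<x : y <ᶠ x) (yx : Adj G y x) →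
                  edgeBetween x y xy ≡ (y , x , y<x , yx)
  edgeBetween-> {x} {y} xy y<x yx with <-cmp x y
  ... | tri< x<y _ _ = contradiction x<y (ℕₚ.<-asym y<x)
  ... | tri≈ _ x≡y _ = contradiction x≡y (Adj⇒≢ xy)
  ... | tri> _ _ _   = Edge-ext _ _ refl refl

  edgeBetween-endˡ : ∀ {x y} (xy : Adj G x y) → Incident {G = G} x (edgeBetween x y xy)
  edgeBetween-endˡ {x} {y} xy with <-cmp x y
  ... | tri< _ _ _   = inj₁ refl
  ... | tri≈ _ x≡y _ = contradiction x≡y (Adj⇒≢ xy)
  ... | tri> _ _ _   = inj₂ refl

  edgeBetween-endʳ : ∀ {x y} (xy : Adj G x y) → Incident {G = G} y (edgeBetween x y xy)
  edgeBetween-endʳ {x} {y} xy with <-cmp x y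
  ... | tri< _ _ _   = inj₂ refl
  ... | tri≈ _ x≡y _ = contradiction x≡y (Adj⇒≢ xy)
  ... | tri> _ _ _   = inj₁ refl

  edgeBetween-end⁻ : ∀ {x y w} (xy : Adj G x y) → Incident {G = G} w (edgeBetween x y xy) → w ≡ x ⊎ w ≡ y
  edgeBetween-end⁻ {x} {y} xy w-end with <-cmp x y | w-end
  ... | tri< _ _ _   | inj₁ w≡x = inj₁ w≡x
  ... | tri< _ _ _   | inj₂ w≡y = inj₂ w≡y
  ... | tri≈ _ x≡y _ | _        = contradiction x≡y (Adj⇒≢ xy)
  ... | tri> _ _ _   | inj₁ w≡y = inj₂ w≡y
  ... | tri> _ _ _   | inj₂ w≡x = inj₁ w≡x

  edgesFrom : Fin n → List (Fin n) → List (Edge G)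
  edgesFrom x []      = []
  edgesFrom x (y ∷ S) with Adj? x y
  ... | yes xy = edgeBetween x y xy ∷ edgesFrom x S
  ... | no _   = edgesFrom x S

  edgesWithin : List (Fin n) → List (Edge G)
  edgesWithin []      = []
  edgesWithin (x ∷ S) = edgesFrom x S ++ edgesWithin S

  degreeIn : Fin n → List (Fin n) → ℕ
  degreeIn x S = length (edgesFrom x S)

  edgeCount : List (Fin n) → ℕ
  edgeCount S = length (edgesWithin S)

  ∈-edgesFrom : ∀ {x y S} (xy : Adj G x y) → y ∈ S → edgeBetween x y xy ∈ edgesFrom x S
  ∈-edgesFrom {x} {y} {z ∷ S} xy y∈ with Adj? x z | y∈
  ... | yes xz | here refl = here (cong (edgeBetween x y) (Adj-irrelevant xy xz))
  ... | yes _  | there y∈S = there (∈-edgesFrom xy y∈S)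
  ... | no ¬xz | here refl = contradiction xy ¬xz
  ... | no _   | there y∈S = ∈-edgesFrom xy y∈S

  ∈-edgesWithin : ∀ {S} (f : Edge G) → lo f ∈ S → hi f ∈ S → f ∈ edgesWithin S
  ∈-edgesWithin {x ∷ S} f@(i , j , i<j , ij) i∈ j∈ with x ≟ i | x ≟ j
  ... | yes refl | _ = ∈-++⁺ˡ (subst (_∈ edgesFrom x S) (edgeBetween-< ij i<j)
                                (∈-edgesFrom ij (Any.tail (λ j≡x → <-irrefl (sym j≡x) i<j) j∈)))
  ... | no _ | yes refl = ∈-++⁺ˡ (subst (_∈ edgesFrom x S) (edgeBetween-> (Adj-sym ij) i<j ij)
                                  (∈-edgesFrom (Adj-sym ij) (Any.tail (λ i≡x → <-irrefl i≡x i<j) i∈)))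
  ... | no x≢i | no x≢j = ∈-++⁺ʳ (edgesFrom x S)
                            (∈-edgesWithin f (Any.tail (x≢i ∘′ sym) i∈) (Any.tail (x≢j ∘′ sym) j∈))

  degreeIn-++ : ∀ x A B → degreeIn x (A ++ B) ≡ degreeIn x A + degreeIn x B
  degreeIn-++ x []      B = refl
  degreeIn-++ x (y ∷ A) B with Adj? x y
  ... | yes _ = cong suc (degreeIn-++ x A B)
  ... | no _  = degreeIn-++ x A B

  degreeIn-[]-comm : ∀ x y → degreeIn x [ y ] ≡ degreeIn y [ x ]
  degreeIn-[]-comm x y with Adj? x y | Adj? y x
  ... | yes _  | yes _  = refl
  ... | no _   | no _   = refl
  ... | yes xy | no ¬yx = contradiction (Adj-sym xy) ¬yx
  ... | no ¬xy | yes yx = contradiction (Adj-sym yx) ¬xy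

  degreeIn-self : ∀ x S → degreeIn x (x ∷ S) ≡ degreeIn x S
  degreeIn-self x S with Adj? x x
  ... | yes xx = contradiction refl (Adj⇒≢ xx)
  ... | no _   = refl

  degreeIn-++-self : ∀ A x B → degreeIn x (A ++ x ∷ B) ≡ degreeIn x (A ++ B)
  degreeIn-++-self A x B = begin
    degreeIn x (A ++ x ∷ B)            ≡⟨ degreeIn-++ x A (x ∷ B) ⟩
    degreeIn x A + degreeIn x (x ∷ B)  ≡⟨ cong (degreeIn x A +_) (degreeIn-self x B) ⟩
    degreeIn x A + degreeIn x B        ≡⟨ sym (degreeIn-++ x A B) ⟩
    degreeIn x (A ++ B)                ∎
    where open ≡-Reasoning

  edgeCount-∷ : ∀ x S → edgeCount (x ∷ S) ≡ degreeIn x S + edgeCount S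
  edgeCount-∷ x S = length-++ (edgesFrom x S)

  edgeCount-++-∷ : ∀ A l B → edgeCount (A ++ l ∷ B) ≡ degreeIn l (A ++ B) + edgeCount (A ++ B)
  edgeCount-++-∷ []      l B = edgeCount-∷ l B
  edgeCount-++-∷ (a ∷ A) l B = begin
    edgeCount (a ∷ A ++ l ∷ B)
      ≡⟨ edgeCount-∷ a (A ++ l ∷ B) ⟩
    degreeIn a (A ++ l ∷ B) + edgeCount (A ++ l ∷ B)
      ≡⟨ cong₂ _+_ (trans (degreeIn-++ a A (l ∷ B)) (cong (degreeIn a A +_) (degreeIn-++ a [ l ] B)))
                   (edgeCount-++-∷ A l B) ⟩
    (degreeIn a A + (degreeIn a [ l ] + degreeIn a B)) + (degreeIn l (A ++ B) + edgeCount (A ++ B))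
      ≡⟨ cong (λ d → (degreeIn a A + (d + degreeIn a B)) + (degreeIn l (A ++ B) + edgeCount (A ++ B)))
              (degreeIn-[]-comm a l) ⟩
    (degreeIn a A + (degreeIn l [ a ] + degreeIn a B)) + (degreeIn l (A ++ B) + edgeCount (A ++ B))
      ≡⟨ shuffle (degreeIn a A) (degreeIn l [ a ]) (degreeIn a B) (degreeIn l (A ++ B)) (edgeCount (A ++ B)) ⟩
    (degreeIn l [ a ] + degreeIn l (A ++ B)) + ((degreeIn a A + degreeIn a B) + edgeCount (A ++ B))
      ≡⟨ sym (cong₂ _+_ (degreeIn-++ l [ a ] (A ++ B))
                        (trans (edgeCount-∷ a (A ++ B)) (cong (_+ edgeCount (A ++ B)) (degreeIn-++ a A B)))) ⟩
    degreeIn l (a ∷ A ++ B) + edgeCount (a ∷ A ++ B) ∎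
    where
    open ≡-Reasoning
    open +-*-Solver
    shuffle : ∀ p q r s t → (p + (q + r)) + (s + t) ≡ (q + s) + ((p + r) + t)
    shuffle = solve 5 (λ p q r s t → (p :+ (q :+ r)) :+ (s :+ t) := (q :+ s) :+ ((p :+ r) :+ t)) refl

  neighbourIn : ∀ {x} S → 1 ≤ degreeIn x S → ∃ λ y → y ∈ S × Adj G x y
  neighbourIn {x} (y ∷ S) d≥1 with Adj? x y
  ... | yes xy = y , here refl , xy
  ... | no _   = let z , z∈S , xz = neighbourIn S d≥1 in z , there z∈S , xz

  twoNeighboursIn : ∀ {x} S → Unique S → 2 ≤ degreeIn x S →
                    ∃₂ λ y₁ y₂ → y₁ ∈ S × y₂ ∈ S × Adj G x y₁ × Adj G x y₂ × y₁ ≢ y₂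
  twoNeighboursIn {x} (y ∷ S) (y∉S ∷ u) d≥2 with Adj? x y
  ... | yes xy = let z , z∈S , xz = neighbourIn S (ℕₚ.≤-pred d≥2)
                 in y , z , here refl , there z∈S , xy , xz , All.lookup y∉S z∈S
  ... | no _   = let y₁ , y₂ , y₁∈ , y₂∈ , xy₁ , xy₂ , y₁≢y₂ = twoNeighboursIn S u d≥2
                 in y₁ , y₂ , there y₁∈ , there y₂∈ , xy₁ , xy₂ , y₁≢y₂

  -- A path in S is kept as h ∷ Q with h the end at which it grows.
  PathIn : List (Fin n) → Fin n → List (Fin n) → Set
  PathIn S h Q = Unique (h ∷ Q) × Linked (Adj G) (h ∷ Q) × All (_∈ S) (h ∷ Q)

  Maximal : List (Fin n) → Fin n → List (Fin n) → Set
  Maximal S h Q = ∀ {y} → y ∈ S → Adj G h y → y ∈ Q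

  open DecMembership (_≟_ {n}) using (_∈?_)

  Extension : List (Fin n) → Fin n → List (Fin n) → Set
  Extension S h Q = ∃ λ y → y ∈ S × Adj G h y × y ∉ h ∷ Q

  extension? : ∀ S h Q → Dec (Extension S h Q)
  extension? S h Q = map′ find (λ (_ , y∈S , ext) → lose y∈S ext)
                          (Any.any? (λ y → Adj? h y ×-dec ¬? (y ∈? h ∷ Q)) S)

  maximal-if-unextendable : ∀ {S h Q} → ¬ Extension S h Q → Maximal S h Q
  maximal-if-unextendable {S} {h} {Q} none {y} y∈S hy with y ∈? h ∷ Q
  ... | yes (here y≡h)  = contradiction (sym y≡h) (Adj⇒≢ hy)
  ... | yes (there y∈Q) = y∈Q
  ... | no y∉           = contradiction (y , y∈S , hy , y∉) none

  maximalPath : ∀ k S h Q → length S ≤ length (h ∷ Q) + k → PathIn S h Q →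
                ∃₂ λ h′ Q′ → PathIn S h′ Q′ × Maximal S h′ Q′
  maximalPath k S h Q len path with extension? S h Q
  maximalPath k S h Q len path | no none = h , Q , path , maximal-if-unextendable none
  maximalPath zero S h Q len (u , _ , inS) | yes (y , y∈S , _ , y∉) =
    contradiction (ℕₚ.≤-trans (Unique⇒length≤ longer (All.lookup (y∈S ∷ inS))) len′) ℕₚ.1+n≰n
    where
    longer : Unique (y ∷ h ∷ Q)
    longer = Allₚ.¬Any⇒All¬ (h ∷ Q) y∉ ∷ u
    len′ : length S ≤ length (h ∷ Q)
    len′ = subst (length S ≤_) (ℕₚ.+-identityʳ _) len
  maximalPath (suc k) S h Q len (u , linked , inS) | yes (y , y∈S , hy , y∉) =
    maximalPath k S y (h ∷ Q) (subst (length S ≤_) (ℕₚ.+-suc _ k) len)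
      (Allₚ.¬Any⇒All¬ (h ∷ Q) y∉ ∷ u , Adj-sym hy ∷ linked , y∈S ∷ inS)

  closing-cycle : ∀ {h q Q y} → Unique (h ∷ q ∷ Q) → Linked (Adj G) (h ∷ q ∷ Q) →
                  y ∈ Q → Adj G h y → HasCycle G
  closing-cycle {h} {q} {Q} {y} u linked y∈Q hy with ∈-∃++ y∈Q
  ... | B , C , refl =
    h , q ∷ B ∷ʳ y , s≤s (subst (1 ≤_) (sym (length-++ B)) (ℕₚ.m≤n+m 1 (length B))) ,
    Unique-++⁻ˡ (h ∷ q ∷ B ∷ʳ y) (subst (λ X → Unique (h ∷ q ∷ X)) (sym (++-assoc B [ y ] C)) u) ,
    Linked-∷ʳ (h ∷ q ∷ B) (Linked-++⁻ˡ (h ∷ q ∷ B ∷ʳ y)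
      (subst (λ X → Linked (Adj G) (h ∷ q ∷ X)) (sym (++-assoc B [ y ] C)) linked)) (Adj-sym hy)

  maximalPath-cycle : ∀ {S h Q y₁ y₂} → PathIn S h Q → Maximal S h Q →
                      y₁ ∈ S → y₂ ∈ S → Adj G h y₁ → Adj G h y₂ → y₁ ≢ y₂ → HasCycle G
  maximalPath-cycle {Q = Q} (u , linked , _) maximal y₁∈S y₂∈S hy₁ hy₂ y₁≢y₂
    with Q | maximal y₁∈S hy₁ | maximal y₂∈S hy₂
  ... | q ∷ Q′ | here y₁≡q  | here y₂≡q  = contradiction (trans y₁≡q (sym y₂≡q)) y₁≢y₂
  ... | q ∷ Q′ | there y₁∈Q | _          = closing-cycle u linked y₁∈Q hy₁
  ... | q ∷ Q′ | here _     | there y₂∈Q = closing-cycle u linked y₂∈Q hy₂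

  -- The growing end of a maximal path has all its neighbours in S on the path,
  -- so two of them would close a cycle.
  ∃-leafIn : Acyclic G → ∀ {S s} → Unique S → s ∈ S → ∃ λ l → l ∈ S × degreeIn l S ≤ 1
  ∃-leafIn acyclic {S} {s} uS s∈S
    with maximalPath (length S) S s [] (ℕₚ.m≤n+m (length S) 1) ([] ∷ [] , [-] , s∈S ∷ [])
  ... | h , Q , path@(_ , _ , h∈S ∷ _) , maximal with degreeIn h S ℕₚ.≤? 1
  ... | yes d≤1 = h , h∈S , d≤1
  ... | no d≰1 =
    let y₁ , y₂ , y₁∈ , y₂∈ , hy₁ , hy₂ , y₁≢y₂ = twoNeighboursIn S uS (ℕₚ.≰⇒> d≰1)
    in contradiction (maximalPath-cycle path maximal y₁∈ y₂∈ hy₁ hy₂ y₁≢y₂) acyclic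

  acyclic⇒edgeCount≤length∸1 : Acyclic G → ∀ {S} → Unique S → edgeCount S ≤ length S ∸ 1
  acyclic⇒edgeCount≤length∸1 acyclic {S} = go (length S) S refl
    where
    go : ∀ k S → length S ≡ k → Unique S → edgeCount S ≤ length S ∸ 1
    go _       []      _   _  = z≤n
    go (suc k) (s ∷ S) len uS with ∃-leafIn acyclic uS (here refl)
    ... | l , l∈ , deg≤1 with ∈-∃++ l∈
    ... | B , C , eq = subst (λ X → edgeCount X ≤ length X ∸ 1) (sym eq) (begin
      edgeCount (B ++ l ∷ C)                    ≡⟨ edgeCount-++-∷ B l C ⟩
      degreeIn l (B ++ C) + edgeCount (B ++ C)  ≤⟨ leaf-step (B ++ C) degR (go k (B ++ C) lenR uR) ⟩
      length (B ++ C)                           ≡⟨ sym (cong (_∸ 1) (length-++-∷ B C)) ⟩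
      length (B ++ l ∷ C) ∸ 1                   ∎)
      where
      open ℕₚ.≤-Reasoning
      uR : Unique (B ++ C)
      uR = Unique-++-∷⁻ B C (subst Unique eq uS)
      lenR : length (B ++ C) ≡ k
      lenR = ℕₚ.suc-injective (trans (sym (length-++-∷ B C)) (trans (cong length (sym eq)) len))
      degR : degreeIn l (B ++ C) ≤ 1
      degR = subst (_≤ 1) (trans (cong (degreeIn l) eq) (degreeIn-++-self B l C)) deg≤1
      leaf-step : ∀ R → degreeIn l R ≤ 1 → edgeCount R ≤ length R ∸ 1 → degreeIn l R + edgeCount R ≤ length R
      leaf-step []      _ _ = z≤n
      leaf-step (_ ∷ _) d c = ℕₚ.+-mono-≤ d c

InnerEdge : ∀ {n} → SimpleGraph n → Fin n → Fin n → Set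
InnerEdge G u v = Adj G u v × (∃ λ a → Adj G u a × a ≢ v) × (∃ λ b → Adj G v b × b ≢ u)

innerEdge? : ∀ {n} (G : SimpleGraph n) → Dec (∃₂ (InnerEdge G))
innerEdge? G = any? λ u → any? λ v →
  Adj? G u v ×-dec (any? (λ a → Adj? G u a ×-dec ¬? (a ≟ v)) ×-dec any? (λ b → Adj? G v b ×-dec ¬? (b ≟ u)))

module InnerEdgeDeletion {n : ℕ} (G : SimpleGraph n) (noIsolated : ∀ w → ∃ (Adj G w))
  {u v a b : Fin n} (uv : Adj G u v) (ua : Adj G u a) (a≢v : a ≢ v) (vb : Adj G v b) (b≢u : b ≢ u) where

  Vertex : Set
  Vertex = Fin n ⊎ Edge G

  _≟ⱽ_ : (x y : Vertex) → Dec (x ≡ y)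
  _≟ⱽ_ = Sumₚ.≡-dec _≟_ (_≟ᴱ_ G)

  open DecMembership _≟ⱽ_ using (_∈?_)

  allVertices : List Vertex
  allVertices = map inj₁ (allFin n) ++ map inj₂ (edgesWithin G (allFin n))

  ∈-allVertices : ∀ z → z ∈ allVertices
  ∈-allVertices (inj₁ w) = ∈-++⁺ˡ (∈-map⁺ inj₁ (∈-allFin w))
  ∈-allVertices (inj₂ f) = ∈-++⁺ʳ (map inj₁ (allFin n))
                             (∈-map⁺ inj₂ (∈-edgesWithin G f (∈-allFin _) (∈-allFin _)))

  length-allVertices : length allVertices ≡ n + edgeCount G (allFin n)
  length-allVertices = begin
    length allVertices
      ≡⟨ length-++ (map inj₁ (allFin n)) ⟩
    length (map inj₁ (allFin n)) + length (map inj₂ (edgesWithin G (allFin n)))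
      ≡⟨ cong₂ _+_ (trans (length-map inj₁ (allFin n)) (length-tabulate id))
                   (length-map inj₂ (edgesWithin G (allFin n))) ⟩
    n + edgeCount G (allFin n) ∎
    where open ≡-Reasoning

  e ea eb : Edge G
  e  = edgeBetween G u v uv
  ea = edgeBetween G u a ua
  eb = edgeBetween G v b vb

  removed : List Vertex
  removed = inj₁ u ∷ inj₂ e ∷ inj₁ v ∷ []

  kept? : ∀ z → Dec (z ∉ removed)
  kept? z = ¬? (z ∈? removed)

  D : List Vertex
  D = deduplicate _≟ⱽ_ (filter kept? allVertices)

  ∈D⁺ : ∀ {z} → z ∉ removed → z ∈ D
  ∈D⁺ {z} z∉ = ∈-deduplicate⁺ _≟ⱽ_ (∈-filter⁺ kept? {xs = allVertices} (∈-allVertices z) z∉)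

  ∈D⁻ : ∀ {z} → z ∈ D → z ∉ removed
  ∈D⁻ z∈D = proj₂ (∈-filter⁻ kept? {xs = allVertices} (∈-deduplicate⁻ _≟ⱽ_ _ z∈D))

  End : Fin n → Set
  End w = w ≡ u ⊎ w ≡ v

  end? : ∀ w → Dec (End w)
  end? w = (w ≟ u) ⊎-dec (w ≟ v)

  vertex-kept : ∀ {w} → ¬ End w → inj₁ w ∉ removed
  vertex-kept ¬end (here refl)                 = ¬end (inj₁ refl)
  vertex-kept ¬end (there (there (here refl))) = ¬end (inj₂ refl)

  edge-kept : ∀ {f w} → Incident {G = G} w f → ¬ End w → inj₂ f ∉ removed
  edge-kept w-end ¬end (there (here refl)) = ¬end (edgeBetween-end⁻ G uv w-end)
  edge-kept _     _    (there (there (here ())))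

  ¬End-a : ¬ End a
  ¬End-a (inj₁ a≡u) = Adj⇒≢ G ua (sym a≡u)
  ¬End-a (inj₂ a≡v) = a≢v a≡v

  ¬End-b : ¬ End b
  ¬End-b (inj₁ b≡u) = b≢u b≡u
  ¬End-b (inj₂ b≡v) = Adj⇒≢ G vb (sym b≡v)

  ea∈D : inj₂ ea ∈ D
  ea∈D = ∈D⁺ (edge-kept (edgeBetween-endʳ G ua) ¬End-a)

  eb∈D : inj₂ eb ∈ D
  eb∈D = ∈D⁺ (edge-kept (edgeBetween-endʳ G vb) ¬End-b)

  u-incident : ∀ {f} → End (lo G f) → End (hi G f) → Incident {G = G} u f
  u-incident                 (inj₁ lo≡u) _           = inj₁ (sym lo≡u)
  u-incident                 _           (inj₁ hi≡u) = inj₂ (sym hi≡u)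
  u-incident {_ , _ , _ , f} (inj₂ lo≡v) (inj₂ hi≡v) = contradiction (trans lo≡v (sym hi≡v)) (Adj⇒≢ G f)

  ≢ea : ∀ {f} → End (lo G f) → End (hi G f) → f ≢ ea
  ≢ea lo-end hi-end refl with edgeBetween-endʳ G ua
  ... | inj₁ a≡lo = ¬End-a (subst End (sym a≡lo) lo-end)
  ... | inj₂ a≡hi = ¬End-a (subst End (sym a≡hi) hi-end)

  dominating : IsTotalDominating (Middle G) D
  dominating (inj₁ w) with end? w
  ... | yes (inj₁ refl) = inj₂ ea , ea∈D , edgeBetween-endˡ G ua
  ... | yes (inj₂ refl) = inj₂ eb , eb∈D , edgeBetween-endˡ G vb
  ... | no ¬end = let z , wz = noIsolated w in
    inj₂ (edgeBetween G w z wz) , ∈D⁺ (edge-kept (edgeBetween-endˡ G wz) ¬end) , edgeBetween-endˡ G wz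
  dominating (inj₂ f) with end? (lo G f) | end? (hi G f)
  ... | no ¬end  | _        = inj₁ (lo G f) , ∈D⁺ (vertex-kept ¬end) , inj₁ refl
  ... | yes _    | no ¬end  = inj₁ (hi G f) , ∈D⁺ (vertex-kept ¬end) , inj₂ refl
  ... | yes lo-e | yes hi-e =
    inj₂ ea , ea∈D , ≢ea lo-e hi-e , u , u-incident {f} lo-e hi-e , edgeBetween-endˡ G ua

  Outside : Vertex → Set
  Outside z = z ∉ D

  removed-outside : ∀ {z} → z ∈ removed → Outside z
  removed-outside z∈ z∈D = ∈D⁻ z∈D z∈

  outside-removed : ∀ {z} → Outside z → z ∈ removed
  outside-removed {z} z∉D with z ∈? removed
  ... | yes z∈ = z∈
  ... | no z∉  = contradiction (∈D⁺ z∉) z∉D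

  u∉D : Outside (inj₁ u)
  u∉D = removed-outside (here refl)
  e∉D : Outside (inj₂ e)
  e∉D = removed-outside (there (here refl))
  v∉D : Outside (inj₁ v)
  v∉D = removed-outside (there (there (here refl)))

  toHub : ∀ z → Outside z → WalkIn (Middle G) Outside z (inj₂ e)
  toHub z z∉D with outside-removed z∉D
  ... | here refl                 = step u∉D (edgeBetween-endˡ G uv) (here e∉D)
  ... | there (here refl)         = here e∉D
  ... | there (there (here refl)) = step v∉D (edgeBetween-endʳ G uv) (here e∉D)

  fromHub : ∀ z → Outside z → WalkIn (Middle G) Outside (inj₂ e) z
  fromHub z z∉D with outside-removed z∉D
  ... | here refl                 = step e∉D (edgeBetween-endˡ G uv) (here u∉D)
  ... | there (here refl)         = here e∉D
  ... | there (there (here refl)) = step e∉D (edgeBetween-endʳ G uv) (here v∉D)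

  complement-connected : InducedConnected (Middle G) Outside
  complement-connected = InducedConnected-hub (inj₂ e) toHub fromHub

  unique-removed++D : Unique (removed ++ D)
  unique-removed++D = Uniqueₚ.++⁺ unique-removed (deduplicate-! _≟ⱽ_ _)
                        (λ (z∈removed , z∈D) → removed-outside z∈removed z∈D)
    where
    unique-removed : Unique removed
    unique-removed = ((λ ()) ∷ (λ { refl → Adj⇒≢ G uv refl }) ∷ []) ∷ ((λ ()) ∷ []) ∷ [] ∷ []

  size : 3 + length D ≤ n + edgeCount G (allFin n)
  size = subst (3 + length D ≤_) length-allVertices
           (Unique⇒length≤ unique-removed++D (λ {z} _ → ∈-allVertices z))

  tocds : IsTOCDS (Middle G) D
  tocds = deduplicate-! _≟ⱽ_ _ , dominating , complement-connected

innerEdge⇒tocds : ∀ {n} (G : SimpleGraph n) → (∀ w → ∃ (Adj G w)) → ∀ {u v} → InnerEdge G u v →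
                  Σ (List (Fin n ⊎ Edge G)) λ D → IsTOCDS (Middle G) D × 3 + length D ≤ n + edgeCount G (allFin n)
innerEdge⇒tocds G noIsolated (uv , (a , ua , a≢v) , (b , vb , b≢u)) = D , tocds , size
  where open InnerEdgeDeletion G noIsolated uv ua a≢v vb b≢u

acyclic⇒edgeCount≤n∸1 : ∀ {n} (G : SimpleGraph n) → Acyclic G → edgeCount G (allFin n) ≤ n ∸ 1
acyclic⇒edgeCount≤n∸1 {n} G acyclic =
  subst (λ k → edgeCount G (allFin n) ≤ k ∸ 1) (length-tabulate {n = n} id)
        (acyclic⇒edgeCount≤length∸1 G acyclic (Uniqueₚ.allFin⁺ n))

connected⇒noIsolated : ∀ {m} (G : SimpleGraph (2 + m)) → Connected G → ∀ w → ∃ (Adj G w)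
connected⇒noIsolated G connected zero    = connected⇒neighbour G connected {zero} {suc zero} (λ ())
connected⇒noIsolated G connected (suc w) = connected⇒neighbour G connected {suc w} {zero} (λ ())

TwoNeighbours : ∀ {n} → SimpleGraph n → Fin n → Set
TwoNeighbours G c = ∃₂ λ y₁ y₂ → Adj G c y₁ × Adj G c y₂ × y₁ ≢ y₂

-- If every vertex had at most one neighbour, {0, x₀} with x₀ the neighbour of 0
-- would be closed under adjacency, yet it misses one of the vertices 1, 2.
connected⇒∃-twoNeighbours : ∀ {m} (G : SimpleGraph (3 + m)) → Connected G → ∃ (TwoNeighbours G)
connected⇒∃-twoNeighbours G connected
  with any? (λ c → any? λ y₁ → any? λ y₂ → Adj? G c y₁ ×-dec (Adj? G c y₂ ×-dec ¬? (y₁ ≟ y₂)))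
... | yes found = found
... | no none   = contradiction (connected-closed G connected closed (inj₁ refl) (proj₁ far)) (proj₂ far)
  where
  neighbour-unique : ∀ {x y z} → Adj G x y → Adj G x z → y ≡ z
  neighbour-unique {x} {y} {z} xy xz with y ≟ z
  ... | yes y≡z = y≡z
  ... | no y≢z  = contradiction (x , y , z , xy , xz , y≢z) none

  x₀ : Fin _
  x₀ = proj₁ (connected⇒noIsolated G connected zero)

  0x₀ : Adj G zero x₀
  0x₀ = proj₂ (connected⇒noIsolated G connected zero)

  Near : Fin _ → Set
  Near y = y ≡ zero ⊎ y ≡ x₀

  closed : ∀ {x y} → Near x → Adj G x y → Near y
  closed (inj₁ refl) xy = inj₂ (neighbour-unique xy 0x₀)
  closed (inj₂ refl) xy = inj₁ (neighbour-unique xy (Adj-sym G 0x₀))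

  far : ∃ λ w → ¬ Near w
  far with x₀ ≟ suc zero
  ... | yes x₀≡1 = suc (suc zero) , λ { (inj₁ ()) ; (inj₂ 2≡x₀) → contradiction (trans 2≡x₀ x₀≡1) (λ ()) }
  ... | no x₀≢1  = suc zero , λ { (inj₁ ()) ; (inj₂ 1≡x₀) → x₀≢1 (sym 1≡x₀) }


centred⇒star : ∀ {m} (G : SimpleGraph (suc m)) (c : Fin (suc m)) →
               (∀ j → j ≢ c → Adj G c j) → (∀ i j → i ≢ c → j ≢ c → ¬ Adj G i j) →
               Isomorphic G (Star (suc m))
centred⇒star {m} G c spoke no-rim = σ , λ i j → preserves i j _ refl _ refl
  where
  σ : Permutation′ (suc m)
  σ = transpose c zero

  σ⁻¹0 : ∀ {i} → Inverse.to σ i ≡ zero → i ≡ c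
  σ⁻¹0 {i} σi≡0 = trans (sym (Inverse.strictlyInverseʳ σ i)) (cong (Inverse.from σ) σi≡0)

  σ-suc : ∀ {i k} → Inverse.to σ i ≡ suc k → i ≢ c
  σ-suc σi≡suc refl with trans (sym (Inverse.strictlyInverseˡ σ zero)) σi≡suc
  ... | ()

  ¬Adj⇒false : ∀ {i j} → ¬ Adj G i j → adj G i j ≡ false
  ¬Adj⇒false {i} {j} ¬ij with adj G i j
  ... | true  = contradiction refl ¬ij
  ... | false = refl

  preserves : ∀ i j si → Inverse.to σ i ≡ si → ∀ sj → Inverse.to σ j ≡ sj → adj G i j ≡ starAdj si sj
  preserves i j zero σi zero σj with σ⁻¹0 {i} σi | σ⁻¹0 {j} σj
  ... | refl | refl = irrefl G c
  preserves i j zero σi (suc _) σj with σ⁻¹0 {i} σi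
  ... | refl = spoke j (σ-suc σj)
  preserves i j (suc _) σi zero σj with σ⁻¹0 {j} σj
  ... | refl = Adj-sym G (spoke i (σ-suc σi))
  preserves i j (suc _) σi (suc _) σj = ¬Adj⇒false (no-rim i j (σ-suc σi) (σ-suc σj))

-- Take c with two neighbours: a neighbour w of c with a further neighbour
-- would make cw an inner edge, so all neighbours of c are leaves.
noInnerEdge⇒star : ∀ {m} (G : SimpleGraph (3 + m)) → Connected G → ¬ ∃₂ (InnerEdge G) →
                   Isomorphic G (Star (3 + m))
noInnerEdge⇒star G connected noInner with connected⇒∃-twoNeighbours G connected
... | c , y₁ , y₂ , cy₁ , cy₂ , y₁≢y₂ = centred⇒star G c spoke no-rim
  where
  leaf : ∀ {w z} → Adj G c w → Adj G w z → z ≡ c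
  leaf {w} {z} cw wz with z ≟ c | y₁ ≟ w
  ... | yes z≡c | _       = z≡c
  ... | no z≢c  | no y₁≢w = contradiction (c , w , cw , (y₁ , cy₁ , y₁≢w) , (z , wz , z≢c)) noInner
  ... | no z≢c  | yes y₁≡w =
    contradiction (c , w , cw , (y₂ , cy₂ , λ y₂≡w → y₁≢y₂ (trans y₁≡w (sym y₂≡w))) , (z , wz , z≢c)) noInner

  Near : Fin _ → Set
  Near y = y ≡ c ⊎ Adj G c y

  closed : ∀ {x y} → Near x → Adj G x y → Near y
  closed (inj₁ refl) cy = inj₂ cy
  closed (inj₂ cx)   xy = inj₁ (leaf cx xy)

  spoke : ∀ j → j ≢ c → Adj G c j
  spoke j j≢c with connected-closed G connected closed (inj₁ refl) j
  ... | inj₁ j≡c = contradiction j≡c j≢c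
  ... | inj₂ cj  = cj

  no-rim : ∀ i j → i ≢ c → j ≢ c → ¬ Adj G i j
  no-rim i j i≢c j≢c ij = j≢c (leaf (spoke i i≢c) ij)

3+l≤1+m+e⇒l≤2[1+m]∸4 : ∀ {m L E} → 3 + L ≤ suc m + E → E ≤ m → L ≤ 2 * suc m ∸ 4
3+l≤1+m+e⇒l≤2[1+m]∸4 {m} {L} {E} 3+L≤ E≤m = ℕₚ.m+n≤o⇒m≤o∸n L (begin
  L + 4           ≡⟨ ℕₚ.+-comm L 4 ⟩
  suc (3 + L)     ≤⟨ s≤s 3+L≤ ⟩
  suc (suc m + E) ≤⟨ s≤s (ℕₚ.+-monoʳ-≤ (suc m) E≤m) ⟩
  suc (suc m + m) ≡⟨ solve 1 (λ m → con 1 :+ (con 1 :+ m :+ m) := con 2 :* (con 1 :+ m)) refl m ⟩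
  2 * suc m       ∎)
  where
  open ℕₚ.≤-Reasoning
  open +-*-Solver

theorem3p4 : (n : ℕ) → 4 ≤ n → (T : SimpleGraph n) → IsTree T →
    ¬ Isomorphic T (Star n) → γtc≤ (Middle T) (2 * n ∸ 4)
theorem3p4 (suc (suc (suc (suc k)))) (s≤s (s≤s (s≤s (s≤s _)))) T (connected , acyclic) notStar
  with innerEdge? T
... | no noInner = contradiction (noInnerEdge⇒star T connected noInner) notStar
... | yes (u , v , inner) =
  let D , tocds , size = innerEdge⇒tocds T (connected⇒noIsolated T connected) inner
  in D , tocds , 3+l≤1+m+e⇒l≤2[1+m]∸4 size (acyclic⇒edgeCount≤n∸1 T acyclic)
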